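{- Let $P$ be a valid PBP of $T$ with following position $i\le n$, and let $\mathsf{SA}_i$ be any permutation of $[1..n]$ with $\mathsf{lcp}(i,\mathsf{SA}_i[1])\ge\mathsf{lcp}(i,\mathsf{SA}_i[2])\ge\cdots\ge\mathsf{lcp}(i,\mathsf{SA}_i[n])$. For $k\in\{1,\dots,n\}$ let $\ell_k=\max\{\mathsf{LF}(P,\mathsf{SA}_i[1]),\dots,\mathsf{LF}(P,\mathsf{SA}_i[k])\}$, and let $\ell_{\mathit{max}}=\max\{\mathsf{LF}(P,1),\dots,\mathsf{LF}(P,n)\}$. If $k_{\mathit{max}}$ is the least index $k$ such that $\ell_k\ge\mathsf{lcp}(i,\mathsf{SA}_i[k])$, then $\ell_{\mathit{max}}=\ell_{k_{\mathit{max}}}$, and $\mathsf{SA}_i[1..k_{\mathit{max}}]$ contains a position $j_{\mathit{max}}$ with $\mathsf{LF}(P,j_{\mathit{max}})=\ell_{\mathit{max}}$.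
   Context: Let $T=T[1]\cdots T[n]$ be a string over an ordered alphabet $\Sigma$ (elements of $\Sigma$ regarded as distinct from integers); $T[a..b]$ is a substring, $T[a..]=T[a..n]$, $\mathsf{lcp}(a,b)$ is the length of the longest common prefix of $T[a..]$ and $T[b..]$. A partial bidirectional parse (PBP) of $T$ is a sequence of phrases $f_1,\dots,f_k$ partitioning a prefix $T[1..m]$, with $f_x=T[s_x..s_x+|f_x|-1]$, $s_1=1$, $s_{x+1}=s_x+|f_x|$; each phrase is a character phrase ($|f_x|=1$, storing $T[s_x]$) or a target phrase $\langle t_x,|f_x|\rangle$ with $t_x\in\{1,\dots,n\}$, $t_x\ne s_x$, $t_x+|f_x|-1\le n$, $T[t_x..t_x+|f_x|-1]=T[s_x..s_x+|f_x|-1]$. The position following $P$ is $i=m+1$. $B_P$ is $P$ followed by character phrases $T[m+1],\dots,T[n]$ (a partition of all of $T$). For $B_P$ define $g^0(x)=T[x]$ if $x$ lies in a character phrase and $g^0(x)=t_p+(x-s_p)$ if $x$ lies in target phrase $f_p$; $g^k(x)=g^{k-1}(x)$ if $g^{k-1}(x)\in\Sigma$, else $g^k(x)=g^0(g^{k-1}(x))$. $P$ is valid if $g^n(x)\in\Sigma$ for all $x\in\{1,\dots,n\}$. $P\cdot f$ denotes appending phrase $f$. $\mathsf{LF}(P,j)=\max(\{0\}\cup\{\ell\in\{1,\dots,\mathsf{lcp}(i,j)\}:P\cdot\langle j,\ell\rangle\text{ is a valid PBP}\})$ for $j\in\{1,\dots,n\}$. -}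

module Defs where

open import Data.Nat using (ℕ; zero; suc; _+_; _∸_; _≤_; _<_; _<ᵇ_; _⊔_)
open import Data.Vec using (Vec; []; _∷_)
open import Data.Maybe using (Maybe; just; nothing)
open import Data.Sum using (_⊎_; inj₁; inj₂)
open import Data.Product using (_×_; Σ; ∃)
open import Data.List using (List; []; _∷_; _∷ʳ_)
open import Data.Bool using (true; false; if_then_else_)
open import Data.Empty using (⊥)
open import Data.Unit using (⊤)
open import Relation.Nullary using (¬_; yes; no)
open import Relation.Binary.Definitions using (DecidableEquality)
open import Relation.Binary.PropositionalEquality using (_≡_; _≢_)

-- Text T = T[1] ⋯ T[n] over alphabet Σ (a vector of length n).
-- at T x = just T[x] for 1 ≤ x ≤ n, nothing otherwise (positions are 1-based).
at : ∀ {Σ : Set} {n : ℕ} → Vec Σ n → ℕ → Maybe Σ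
at []       _             = nothing
at (c ∷ _)  zero          = nothing
at (c ∷ _)  (suc zero)    = just c
at (_ ∷ cs) (suc (suc x)) = at cs (suc x)

module Text {Σ : Set} (_≟_ : DecidableEquality Σ) {n : ℕ} (T : Vec Σ n) where

  -- lcp(a,b): length of the longest common prefix of T[a..] and T[b..]
  -- (computed with fuel; n+1 steps always suffice).
  lcpGo : ℕ → ℕ → ℕ → ℕ
  lcpGo zero     a b = zero
  lcpGo (suc f)  a b with at T a | at T b
  ... | just c | just d with c ≟ d
  ...   | yes _ = suc (lcpGo f (suc a) (suc b))
  ...   | no  _ = zero
  lcpGo (suc f) a b | _ | _ = zero

  lcp : ℕ → ℕ → ℕ
  lcp a b = lcpGo (suc n) a b

  -- Phrases: a character phrase (storing a character) or a target phrase ⟨t , len⟩.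
  data Phrase : Set where
    chr : Σ → Phrase
    tgt : ℕ → ℕ → Phrase

  len : Phrase → ℕ
  len (chr _)   = 1
  len (tgt _ l) = l

  -- Well-formedness of a sequence of phrases starting at position s
  -- (partitioning T[s..m] for some m ≤ n).
  PBPFrom : ℕ → List Phrase → Set
  PBPFrom s []              = s ≤ suc n
  PBPFrom s (chr c ∷ P)     = (at T s ≡ just c) × PBPFrom (suc s) P
  PBPFrom s (tgt t l ∷ P)   =
    (1 ≤ l) × (1 ≤ t) × (t ≢ s) × (t + l ∸ 1 ≤ n) ×
    (∀ k → k < l → at T (t + k) ≡ at T (s + k)) × PBPFrom (s + l) P

  IsPBP : List Phrase → Set
  IsPBP P = PBPFrom 1 P

  nextFrom : ℕ → List Phrase → ℕ
  nextFrom s []      = s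
  nextFrom s (f ∷ P) = nextFrom (s + len f) P

  following : List Phrase → ℕ
  following P = nextFrom 1 P

  Val : Set
  Val = ℕ ⊎ Σ

  -- T[x] as a value (out-of-range positions are mapped to themselves; never
  -- reached from 1..n in a PBP since all targets lie in 1..n)
  charVal : ℕ → Val
  charVal x with at T x
  ... | just c  = inj₂ c
  ... | nothing = inj₁ x

  -- g⁰ for B_P: phrases of P, then character phrases T[m+1], …, T[n]
  g0From : ℕ → List Phrase → ℕ → Val
  g0From s []      x = charVal x
  g0From s (f ∷ P) x with x <ᵇ s + len f
  g0From s (chr c ∷ P)   x | true  = charVal x
  g0From s (tgt t l ∷ P) x | true  = inj₁ (t + (x ∸ s))
  g0From s (f ∷ P)       x | false = g0From (s + len f) P x

  g0 : List Phrase → ℕ → Val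
  g0 P = g0From 1 P

  g : List Phrase → ℕ → ℕ → Val
  g P zero    x = g0 P x
  g P (suc k) x with g P k x
  ... | inj₂ c = inj₂ c
  ... | inj₁ y = g0 P y

  IsChar : Val → Set
  IsChar (inj₁ _) = ⊥
  IsChar (inj₂ _) = ⊤

  Valid : List Phrase → Set
  Valid P = ∀ x → 1 ≤ x → x ≤ n → IsChar (g P n x)

  ValidPBP : List Phrase → Set
  ValidPBP P = IsPBP P × Valid P

  -- IsLF P j ℓ  :⇔  ℓ = LF(P,j) = max({0} ∪ {ℓ' ∈ 1..lcp(i,j) : P·⟨j,ℓ'⟩ valid PBP})
  IsLF : List Phrase → ℕ → ℕ → Set
  IsLF P j ℓ =
    (ℓ ≡ 0 ⊎ (1 ≤ ℓ × ℓ ≤ lcp (following P) j × ValidPBP (P ∷ʳ tgt j ℓ))) ×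
    (∀ ℓ' → 1 ≤ ℓ' → ℓ' ≤ lcp (following P) j → ValidPBP (P ∷ʳ tgt j ℓ') → ℓ' ≤ ℓ)

prefMax : (ℕ → ℕ) → (ℕ → ℕ) → ℕ → ℕ
prefMax f SA zero    = 0
prefMax f SA (suc k) = prefMax f SA k ⊔ f (SA (suc k))

-- LF(P,j) ≤ lcp(i,j) for every j, and lcp(i,·) is non-increasing along SA_i, so for k > k_max
-- LF(P,SA_i[k]) ≤ lcp(i,SA_i[k]) ≤ lcp(i,SA_i[k_max]) ≤ ℓ_{k_max}; for k ≤ k_max this bound holds
-- by definition of ℓ_{k_max}. As SA_i is a permutation this bounds every LF(P,j), so ℓ_max = ℓ_{k_max},
-- which is attained on SA_i[1..k_max] like any prefix maximum.
module Submission where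

open import Defs
open import Data.Nat using (ℕ; zero; suc; _≤_; _<_; _≥_; z≤n; s≤s; _≤?_)
open import Data.Nat.Properties
open import Data.Fin using (Fin; toℕ; fromℕ<; punchOut)
open import Data.Fin.Properties using (any?; pigeonhole; punchOut-injective; toℕ-injective; toℕ-fromℕ<; toℕ<n)
  renaming (_≟_ to _≟ᶠ_; <⇒≢ to <⇒≢ᶠ)
open import Data.Vec using (Vec)
open import Data.List using (List)
open import Data.Product using (_×_; ∃; _,_)
open import Data.Sum using (inj₁; inj₂)
open import Relation.Nullary using (yes; no)
open import Relation.Nullary.Negation using (contradiction)
open import Relation.Binary.Definitions using (DecidableEquality)
open import Relation.Binary.PropositionalEquality using (_≡_; _≢_; refl; sym; trans; cong)
open import Function using (id; _∘′_)

injective⇒surjective : ∀ {n} (f : Fin n → Fin n) → (∀ {a b} → f a ≡ f b → a ≡ b)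
                     → ∀ j → ∃ λ k → f k ≡ j
injective⇒surjective {suc m} f f-inj j with any? (λ k → f k ≟ᶠ j)
... | yes hit = hit
... | no miss =
  let a , b , a<b , ga≡gb = pigeonhole (n<1+n m) (λ k → punchOut (avoids k))
  in contradiction (f-inj (punchOut-injective (avoids a) (avoids b) ga≡gb)) (<⇒≢ᶠ a<b)
  where
  avoids : ∀ k → j ≢ f k
  avoids k j≡fk = miss (k , sym j≡fk)

module Positions (n : ℕ) where

  InRange : ℕ → Set
  InRange x = 1 ≤ x × x ≤ n

  toPos : Fin n → ℕ
  toPos k = suc (toℕ k)

  toPos-inRange : ∀ k → InRange (toPos k)
  toPos-inRange k = s≤s z≤n , toℕ<n k

  fromPos : ∀ x → InRange x → Fin n
  fromPos (suc x) (_ , x<n) = fromℕ< x<n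

  toPos-fromPos : ∀ x (r : InRange x) → toPos (fromPos x r) ≡ x
  toPos-fromPos (suc x) (_ , x<n) = cong suc (toℕ-fromℕ< x<n)

  toPos-injective : ∀ {a b} → toPos a ≡ toPos b → a ≡ b
  toPos-injective = toℕ-injective ∘′ suc-injective

  injectiveOn⇒surjectiveOn : (f : ℕ → ℕ) → (∀ x → 1 ≤ x → x ≤ n → InRange (f x))
    → (∀ x y → 1 ≤ x → x ≤ n → 1 ≤ y → y ≤ n → f x ≡ f y → x ≡ y)
    → ∀ y → InRange y → ∃ λ x → InRange x × f x ≡ y
  injectiveOn⇒surjectiveOn f f-into f-inj y y-in = preimage (injective⇒surjective F F-inj (fromPos y y-in))
    where
    F : Fin n → Fin n
    F k = fromPos (f (toPos k)) (f-into _ (s≤s z≤n) (toℕ<n k))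

    toPos-F : ∀ k → toPos (F k) ≡ f (toPos k)
    toPos-F k = toPos-fromPos _ _

    F-inj : ∀ {a b} → F a ≡ F b → a ≡ b
    F-inj {a} {b} Fa≡Fb = toPos-injective (f-inj _ _ (s≤s z≤n) (toℕ<n a) (s≤s z≤n) (toℕ<n b)
      (trans (sym (toPos-F a)) (trans (cong toPos Fa≡Fb) (toPos-F b))))

    preimage : ∃ (λ k → F k ≡ fromPos y y-in) → ∃ λ x → InRange x × f x ≡ y
    preimage (k , Fk≡y) =
      toPos k , toPos-inRange k , trans (sym (toPos-F k)) (trans (cong toPos Fk≡y) (toPos-fromPos y y-in))

prefMax-lub : ∀ (f SA : ℕ → ℕ) k {m} → (∀ k' → 1 ≤ k' → k' ≤ k → f (SA k') ≤ m) → prefMax f SA k ≤ m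
prefMax-lub f SA zero    bound = z≤n
prefMax-lub f SA (suc k) bound =
  ⊔-lub (prefMax-lub f SA k (λ k' 1≤k' k'≤k → bound k' 1≤k' (m≤n⇒m≤1+n k'≤k))) (bound (suc k) (s≤s z≤n) ≤-refl)

≤-prefMax : ∀ (f SA : ℕ → ℕ) k {k'} → 1 ≤ k' → k' ≤ k → f (SA k') ≤ prefMax f SA k
≤-prefMax f SA zero    1≤k' k'≤0 = contradiction (≤-trans 1≤k' k'≤0) λ ()
≤-prefMax f SA (suc k) 1≤k' k'≤sk with m≤n⇒m<n∨m≡n k'≤sk
... | inj₁ (s≤s k'≤k) = ≤-trans (≤-prefMax f SA k 1≤k' k'≤k) (m≤m⊔n _ _)
... | inj₂ refl       = m≤n⊔m (prefMax f SA k) _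

prefMax-attained : ∀ (f SA : ℕ → ℕ) k → 1 ≤ k → ∃ λ k' → 1 ≤ k' × k' ≤ k × f (SA k') ≡ prefMax f SA k
prefMax-attained f SA (suc k) _ with ⊔-sel (prefMax f SA k) (f (SA (suc k)))
... | inj₂ max≡new = suc k , s≤s z≤n , ≤-refl , sym max≡new
prefMax-attained f SA (suc zero)    _ | inj₁ _ = 1 , s≤s z≤n , ≤-refl , refl
prefMax-attained f SA (suc (suc k)) _ | inj₁ max≡old
  with k' , 1≤k' , k'≤k , attained ← prefMax-attained f SA (suc k) (s≤s z≤n)
  = k' , 1≤k' , m≤n⇒m≤1+n k'≤k , trans attained (sym max≡old)

stepwise-antitone : ∀ {n} (h : ℕ → ℕ) → (∀ k → 1 ≤ k → k < n → h (suc k) ≤ h k)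
                  → ∀ a b → 1 ≤ a → a ≤ b → b ≤ n → h b ≤ h a
stepwise-antitone h step a zero    1≤a a≤0 _ = contradiction (≤-trans 1≤a a≤0) λ ()
stepwise-antitone h step a (suc b) 1≤a a≤sb sb≤n with m≤n⇒m<n∨m≡n a≤sb
... | inj₁ (s≤s a≤b) = ≤-trans (step b (≤-trans 1≤a a≤b) sb≤n) (stepwise-antitone h step a b 1≤a a≤b (<⇒≤ sb≤n))
... | inj₂ refl      = ≤-refl

prefMax-bounds-antitone-tail : ∀ {n} (f h SA : ℕ → ℕ) → (∀ k → 1 ≤ k → k ≤ n → f (SA k) ≤ h k)
  → (∀ k → 1 ≤ k → k < n → h (suc k) ≤ h k)
  → ∀ kmax → 1 ≤ kmax → h kmax ≤ prefMax f SA kmax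
  → ∀ k → 1 ≤ k → k ≤ n → f (SA k) ≤ prefMax f SA kmax
prefMax-bounds-antitone-tail f h SA f≤h step kmax 1≤kmax h≤max k 1≤k k≤n with k ≤? kmax
... | yes k≤kmax = ≤-prefMax f SA kmax 1≤k k≤kmax
... | no  k≰kmax = begin
  f (SA k)               ≤⟨ f≤h k 1≤k k≤n ⟩
  h k                    ≤⟨ stepwise-antitone h step kmax k 1≤kmax (<⇒≤ (≰⇒> k≰kmax)) k≤n ⟩
  h kmax                 ≤⟨ h≤max ⟩
  prefMax f SA kmax      ∎
  where open ≤-Reasoning

module _ {Σ : Set} (_≟_ : DecidableEquality Σ) {n : ℕ} (T : Vec Σ n) where
  open Text _≟_ T

  IsLF⇒≤lcp : ∀ {P j ℓ} → IsLF P j ℓ → ℓ ≤ lcp (following P) j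
  IsLF⇒≤lcp (inj₁ refl , _)           = z≤n
  IsLF⇒≤lcp (inj₂ (_ , ℓ≤lcp , _) , _) = ℓ≤lcp

lemma1 : {Σ : Set} (_≟_ : DecidableEquality Σ) (n : ℕ) (T : Vec Σ n)
  → let open Text _≟_ T in
    (P : List Phrase) → ValidPBP P → following P ≤ n
  → (SA : ℕ → ℕ)
  → (∀ k → 1 ≤ k → k ≤ n → 1 ≤ SA k × SA k ≤ n)
  → (∀ k k' → 1 ≤ k → k ≤ n → 1 ≤ k' → k' ≤ n → SA k ≡ SA k' → k ≡ k')
  → (∀ k → 1 ≤ k → k < n → lcp (following P) (SA k) ≥ lcp (following P) (SA (suc k)))
  → (LF : ℕ → ℕ) → (∀ j → 1 ≤ j → j ≤ n → IsLF P j (LF j))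
  → (kmax : ℕ) → 1 ≤ kmax → kmax ≤ n
  → prefMax LF SA kmax ≥ lcp (following P) (SA kmax)
  → (∀ k → 1 ≤ k → k < kmax → prefMax LF SA k < lcp (following P) (SA k))
  → prefMax LF id n ≡ prefMax LF SA kmax
    × ∃ λ k → 1 ≤ k × k ≤ kmax × LF (SA k) ≡ prefMax LF id n
lemma1 _≟_ n T P _ _ SA SA-into SA-inj lcp-antitone LF isLF kmax 1≤kmax kmax≤n lcp≤ℓ _ =
  ℓmax≡ℓkmax , ℓmax-attained
  where
  open Text _≟_ T
  open Positions n

  LF≤lcp : ∀ k → 1 ≤ k → k ≤ n → LF (SA k) ≤ lcp (following P) (SA k)
  LF≤lcp k 1≤k k≤n = let (1≤j , j≤n) = SA-into k 1≤k k≤n in IsLF⇒≤lcp _≟_ T (isLF (SA k) 1≤j j≤n)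

  LF≤ℓkmax : ∀ j → 1 ≤ j → j ≤ n → LF j ≤ prefMax LF SA kmax
  LF≤ℓkmax j 1≤j j≤n with k , (1≤k , k≤n) , refl ← injectiveOn⇒surjectiveOn SA SA-into SA-inj j (1≤j , j≤n) =
    prefMax-bounds-antitone-tail LF (λ k → lcp (following P) (SA k)) SA LF≤lcp lcp-antitone kmax 1≤kmax lcp≤ℓ k 1≤k k≤n

  ℓmax≡ℓkmax : prefMax LF id n ≡ prefMax LF SA kmax
  ℓmax≡ℓkmax = ≤-antisym (prefMax-lub LF id n LF≤ℓkmax)
    (prefMax-lub LF SA kmax λ k 1≤k k≤kmax →
      let (1≤j , j≤n) = SA-into k 1≤k (≤-trans k≤kmax kmax≤n) in ≤-prefMax LF id n 1≤j j≤n)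

  ℓmax-attained : ∃ λ k → 1 ≤ k × k ≤ kmax × LF (SA k) ≡ prefMax LF id n
  ℓmax-attained with k , 1≤k , k≤kmax , attained ← prefMax-attained LF SA kmax 1≤kmax =
    k , 1≤k , k≤kmax , trans attained (sym ℓmax≡ℓkmax)
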